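{- In the sheaf semantics for first-order dynamic epistemic logic (Kripke-sheaf models with pullback updates), the quantifier reduction axiom $$[E,e]\,\forall y.\,\varphi\ \equiv\ \forall y.\,[E,e]\,\varphi$$ is valid: for every Kripke-sheaf model $(\pi,[\![-]\!]_\pi)$, every event model $(E,R_E)$ with event $e\in E$, and every formula-in-context $(\bar x,y\mid\varphi)$ with $\bar x=(x_1,\dots,x_n)$, we have $[\![\bar x\mid[E,e]\forall y.\varphi]\!]_\pi=[\![\bar x\mid\forall y.[E,e]\varphi]\!]_\pi$.
   Context: Kripke frame: $(X,R_X)$ with $R_X\subseteq X\times X$. A Kripke sheaf is a function $\pi:D\to X$ between Kripke frames $(D,R_D)$, $(X,R_X)$ such that $aR_Db\Rightarrow\pi(a)R_X\pi(b)$; if $\pi(a)R_Xw'$ then $aR_Db$ for some $b$ with $\pi(b)=w'$; and $aR_Db$, $aR_Db'$, $\pi(b)=\pi(b')$ imply $b=b'$. $D^k_X=\{\bar a\in D^k\mid \pi(a_1)=\dots=\pi(a_k)\}$ ($D^0_X=X$), $\pi^k(\bar a)=\pi(a_i)$, $\bar aR_{D^k_X}\bar b$ iff $a_iR_Db_i$ for all $i$. The language is first-order (function and relation symbols) with modal operators $\Box,\Diamond$ and dynamic operators $[E,e],\langle E,e\rangle$ for event models $(E,R_E)$ (Kripke frames whose events $e$ carry closed precondition sentences $\mathrm{Pre}(e)$) and $e\in E$. A Kripke-sheaf model assigns to each $k$-ary function symbol $f$ a map $[\![f]\!]:D^k_X\to D$ with $\pi\circ[\![f]\!]=\pi^k$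 and $\bar aR_{D^k_X}\bar b\Rightarrow[\![f]\!](\bar a)R_D[\![f]\!](\bar b)$, and to each $k$-ary relation symbol $F$ a subset $[\![F]\!]\subseteq D^k_X$. A term in context $(y_1,\dots,y_m)$ is interpreted as a map $D^m_X\to D$ (variables as projections, composition for function application); a formula-in-context $(x_1,\dots,x_k\mid\varphi)$ as a subset of $D^k_X$: atomic $F(t_1,\dots,t_j)$ as the preimage of $[\![F]\!]$ under $\bar a\mapsto([\![t_1]\!](\bar a),\dots,[\![t_j]\!](\bar a))$; $\wedge,\neg$ Boolean; $\bar a\in[\![\bar x\mid\forall y.\varphi]\!]$ iff $(\bar a,b)\in[\![\bar x,y\mid\varphi]\!]$ for all $b\in D$ with $(\bar a,b)\in D^{k+1}_X$ ($\exists$ dually); $\bar a\in[\![\bar x\mid\Box\varphi]\!]$ iff $\bar b\in[\![\bar x\mid\varphi]\!]$ for all $\bar b$ with $\bar aR_{D^k_X}\bar b$ ($\Diamond$ dually). Pullback update: $X\otimes E=\{(w,e)\mid w\in[\![\mathrm{Pre}(e)]\!]_\pi\}$ with pairwise relation; the updated model has residence map $D_{X\otimes E}=\{(a,e)\mid\pi(a)\in[\![\mathrm{Pre}(e)]\!]_\pi\}\to X\otimes E$, $(a,e)\mapsto(\pi(a),e)$, with $(a,e_1)R(b,e_2)$ iff $aR_Db$ and $e_1R_Ee_2$; its $k$-tuples are identified with $D^k_{X\otimes E}=\{(\bar a,e)\mid\pi^k(\bar a)\in[\![\mathrm{Pre}(e)]\!]_\pi\}$ (relation: $a_iR_Db_i$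 for all $i$ and $e_1R_Ee_2$), $[\![f]\!]_{\pi_{X\otimes E}}(\bar a,e)=([\![f]\!]_\pi(\bar a),e)$, $[\![F]\!]_{\pi_{X\otimes E}}=\{(\bar a,e)\mid\bar a\in[\![F]\!]_\pi\}$; it is again a Kripke-sheaf model, interpreting all formulas (including nested dynamic operators) recursively. Dynamic operators: $\bar a\in[\![\bar x\mid[E,e]\varphi]\!]_\pi$ iff $\pi^k(\bar a)\notin[\![\mathrm{Pre}(e)]\!]_\pi$ or $(\bar a,e)\in[\![\bar x\mid\varphi]\!]_{\pi_{X\otimes E}}$; $\bar a\in[\![\bar x\mid\langle E,e\rangle\varphi]\!]_\pi$ iff $\pi^k(\bar a)\in[\![\mathrm{Pre}(e)]\!]_\pi$ and $(\bar a,e)\in[\![\bar x\mid\varphi]\!]_{\pi_{X\otimes E}}$. -}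

module Defs where

open import Data.Nat using (ℕ; zero; suc)
open import Data.Fin using (Fin)
open import Data.Vec using (Vec; []; _∷_; map; lookup)
open import Data.Product using (Σ; Σ-syntax; _×_; _,_; proj₁; proj₂)
open import Data.Empty using (⊥)
open import Relation.Nullary using (¬_)
open import Relation.Binary.PropositionalEquality using (_≡_; refl; cong)

record Signature : Set₁ where
  field
    Fun : ℕ → Set
    Rel : ℕ → Set

module Syntax (Sg : Signature) where
  open Signature Sg

  data Term (n : ℕ) : Set where
    var : Fin n → Term n
    app : ∀ {k} → Fun k → Vec (Term n) k → Term n

  mutual
    record EventModel : Set₁ where
      inductive
      constructor eventModel
      field
        Ev  : Set
        REv : Ev → Ev → Set
        Pre : Ev → Formula 0

    -- formulas in a context of n variables; ∀ / ∃ bind the new variable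
    -- as index zero, i.e. context (x̄ , y) with y the newest variable
    data Formula (n : ℕ) : Set₁ where
      atom  : ∀ {k} → Rel k → Vec (Term n) k → Formula n
      _∧_   : Formula n → Formula n → Formula n
      ~_    : Formula n → Formula n
      ∀'    : Formula (suc n) → Formula n
      ∃'    : Formula (suc n) → Formula n
      □_    : Formula n → Formula n
      ◇_    : Formula n → Formula n
      [_,_]_ : (𝔼 : EventModel) → EventModel.Ev 𝔼 → Formula n → Formula n
      ⟨_,_⟩_ : (𝔼 : EventModel) → EventModel.Ev 𝔼 → Formula n → Formula n

record KFrameMap : Set₁ where
  field
    X  : Set
    RX : X → X → Set
    D  : Set
    RD : D → D → Set
    π  : D → X

  Fib : X → Set
  Fib w = Σ[ a ∈ D ] π a ≡ w

  -- D^k_X : k-tuples of elements in a common fibre, together with that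
  -- common world (for k = 0 this is just X)
  Tuple : ℕ → Set
  Tuple k = Σ[ w ∈ X ] Vec (Fib w) k

  -- R_{D^k_X}: componentwise R_D (and R_X on the common worlds, which is
  -- the relation of D^0_X = X, and is implied for k ≥ 1 since π is monotone)
  TupleR : ∀ {k} → Tuple k → Tuple k → Set
  TupleR {k} (w , a) (w' , b) =
    RX w w' × ((i : Fin k) → RD (proj₁ (lookup a i)) (proj₁ (lookup b i)))

record IsKripkeSheaf (K : KFrameMap) : Set where
  open KFrameMap K
  field
    monotone : ∀ a b → RD a b → RX (π a) (π b)
    lifting  : ∀ a w' → RX (π a) w' → Σ[ b ∈ D ] (RD a b × π b ≡ w')
    unique   : ∀ a b b' → RD a b → RD a b' → π b ≡ π b' → b ≡ b'

-- interpretation of the symbols: [[f]] : D^k_X → D with π ∘ [[f]] = π^k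
-- (encoded by landing in the fibre), [[F]] ⊆ D^k_X
record Interp (Sg : Signature) (K : KFrameMap) : Set₁ where
  open Signature Sg
  open KFrameMap K
  field
    fun : ∀ {k} → Fun k → (t : Tuple k) → Fib (proj₁ t)
    rel : ∀ {k} → Rel k → Tuple k → Set

record IsSheafModel (Sg : Signature) (K : KFrameMap) (I : Interp Sg K) : Set where
  open Signature Sg
  open KFrameMap K
  open Interp I
  field
    isKripkeSheaf : IsKripkeSheaf K
    funMonotone   : ∀ {k} (f : Fun k) (s t : Tuple k) → TupleR s t →
                    RD (proj₁ (fun f s)) (proj₁ (fun f t))

-- Pullback update of a model along an event model, given the extension
-- P e w  of the precondition of e (evaluated in the old model)

module Update (K : KFrameMap) (E : Set) (RE : E → E → Set)
              (P : E → KFrameMap.X K → Set) where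
  open KFrameMap K

  updK : KFrameMap
  updK = record
    { X  = Σ[ w ∈ X ] Σ[ e ∈ E ] P e w
    ; RX = λ { (w , e , _) (w' , e' , _) → RX w w' × RE e e' }
    ; D  = Σ[ a ∈ D ] Σ[ e ∈ E ] P e (π a)
    ; RD = λ { (a , e , _) (b , e' , _) → RD a b × RE e e' }
    ; π  = λ { (a , e , p) → (π a , e , p) }
    }

  liftFib : ∀ {w} (e : E) (p : P e w) → Fib w → KFrameMap.Fib updK (w , e , p)
  liftFib e p (a , refl) = (a , e , p) , refl

  lowerFib : ∀ {w'} → KFrameMap.Fib updK w' → Fib (proj₁ w')
  lowerFib ((a , _ , _) , eq) = a , cong proj₁ eq

  updI : ∀ {Sg} → Interp Sg K → Interp Sg updK
  updI I = record
    { fun = λ { f ((w , e , p) , a') → liftFib e p (Interp.fun I f (w , map lowerFib a')) }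
    ; rel = λ { F ((w , e , p) , a') → Interp.rel I F (w , map lowerFib a') }
    }

module Semantics (Sg : Signature) where
  open Signature Sg
  open Syntax Sg

  mutual
    ⟦_⟧t : ∀ {n} → Term n → (K : KFrameMap) → Interp Sg K →
           (t : KFrameMap.Tuple K n) → KFrameMap.Fib K (proj₁ t)
    ⟦ var i ⟧t K I (w , a) = lookup a i
    ⟦ app f ts ⟧t K I (w , a) = Interp.fun I f (w , ⟦ ts ⟧ts K I (w , a))

    ⟦_⟧ts : ∀ {n k} → Vec (Term n) k → (K : KFrameMap) → (I : Interp Sg K) →
            (t : KFrameMap.Tuple K n) → Vec (KFrameMap.Fib K (proj₁ t)) k
    ⟦ [] ⟧ts K I t = []
    ⟦ s ∷ ts ⟧ts K I t = ⟦ s ⟧t K I t ∷ ⟦ ts ⟧ts K I t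

  ⟦_⟧ : ∀ {n} → Formula n → (K : KFrameMap) → Interp Sg K →
        KFrameMap.Tuple K n → Set
  ⟦ atom F ts ⟧ K I (w , a) = Interp.rel I F (w , ⟦ ts ⟧ts K I (w , a))
  ⟦ φ ∧ ψ ⟧ K I t = ⟦ φ ⟧ K I t × ⟦ ψ ⟧ K I t
  ⟦ ~ φ ⟧ K I t = ¬ ⟦ φ ⟧ K I t
  ⟦ ∀' φ ⟧ K I (w , a) = (b : KFrameMap.Fib K w) → ⟦ φ ⟧ K I (w , b ∷ a)
  ⟦ ∃' φ ⟧ K I (w , a) = Σ[ b ∈ KFrameMap.Fib K w ] ⟦ φ ⟧ K I (w , b ∷ a)
  ⟦ □ φ ⟧ K I t = (t' : KFrameMap.Tuple K _) → KFrameMap.TupleR K t t' → ⟦ φ ⟧ K I t'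
  ⟦ ◇ φ ⟧ K I t = Σ[ t' ∈ KFrameMap.Tuple K _ ] (KFrameMap.TupleR K t t' × ⟦ φ ⟧ K I t')
  ⟦ [ eventModel E RE pre , e ] φ ⟧ K I (w , a) =
    (p : ⟦ pre e ⟧ K I (w , [])) →
    ⟦ φ ⟧ (Update.updK K E RE P) (Update.updI K E RE P I)
          ((w , e , p) , map (Update.liftFib K E RE P e p) a)
    where P = λ e' w' → ⟦ pre e' ⟧ K I (w' , [])
  ⟦ ⟨ eventModel E RE pre , e ⟩ φ ⟧ K I (w , a) =
    Σ[ p ∈ ⟦ pre e ⟧ K I (w , []) ]
    ⟦ φ ⟧ (Update.updK K E RE P) (Update.updI K E RE P I)
          ((w , e , p) , map (Update.liftFib K E RE P e p) a)
    where P = λ e' w' → ⟦ pre e' ⟧ K I (w' , [])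

module Submission where

-- The reduction axiom  [E,e] ∀y.φ ≡ ∀y.[E,e] φ  holds because the pullback
-- update does not change the fibres: over an updated world (w , e , p) the
-- fibre of the updated residence map consists exactly of the pairs (a , e)
-- with a in the fibre over w.  So, once the precondition p of e is fixed,
-- quantifying over the new fibre is the same as quantifying over the old
-- fibre composed with the lifting a ↦ (a , e).

open import Defs
open import Data.Nat using (ℕ; suc)
open import Data.Vec using ([]; _∷_; map)
open import Data.Product using (Σ-syntax; _,_)
open import Function.Bundles using (_⇔_; mk⇔; Equivalence)
open import Relation.Binary.PropositionalEquality using (_≡_; refl; subst)

module _ (K : KFrameMap) (E : Set) (RE : E → E → Set)
         (P : E → KFrameMap.X K → Set) where
  open KFrameMap K using (Fib)
  open Update K E RE P using (updK; liftFib)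

  liftFib-onto : ∀ {w} (e : E) (p : P e w) (c : KFrameMap.Fib updK (w , e , p)) →
                 Σ[ b ∈ Fib w ] liftFib e p b ≡ c
  liftFib-onto e p ((a , .e , .p) , refl) = (a , refl) , refl

  ∀-updatedFibre⇔∀-lift : ∀ {w} (e : E) (p : P e w)
                          (Q : KFrameMap.Fib updK (w , e , p) → Set) →
                          ((c : KFrameMap.Fib updK (w , e , p)) → Q c)
                            ⇔ ((b : Fib w) → Q (liftFib e p b))
  ∀-updatedFibre⇔∀-lift e p Q = mk⇔ (λ h b → h (liftFib e p b)) fromLifts
    where
    fromLifts : ((b : Fib _) → Q (liftFib e p b)) → (c : KFrameMap.Fib updK _) → Q c
    fromLifts h c with liftFib-onto e p c
    ... | b , lift-b≡c = subst Q lift-b≡c (h b)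

mainTheorem6 : (Sg : Signature) (K : KFrameMap) (I : Interp Sg K) →
    IsSheafModel Sg K I →
    (𝔼 : Syntax.EventModel Sg) (e : Syntax.EventModel.Ev {Sg} 𝔼) →
    {n : ℕ} (φ : Syntax.Formula Sg (suc n)) (t : KFrameMap.Tuple K n) →
    Semantics.⟦_⟧ Sg (Syntax.[_,_]_ 𝔼 e (Syntax.∀' φ)) K I t
      ⇔ Semantics.⟦_⟧ Sg (Syntax.∀' (Syntax.[_,_]_ 𝔼 e φ)) K I t
mainTheorem6 Sg K I _ (Syntax.eventModel E RE pre) e φ (w , a) =
  mk⇔ (λ h b p → Equivalence.to (fibres p) (h p) b)
      (λ h p → Equivalence.from (fibres p) (λ b → h b p))
  where
  open Semantics Sg using (⟦_⟧)

  Pre : E → KFrameMap.X K → Set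
  Pre e' w' = ⟦ pre e' ⟧ K I (w' , [])

  open Update K E RE Pre using (updK; updI; liftFib)

  φ-after : (p : Pre e w) → KFrameMap.Fib updK (w , e , p) → Set
  φ-after p c = ⟦ φ ⟧ updK (updI I) ((w , e , p) , c ∷ map (liftFib e p) a)

  fibres : (p : Pre e w) →
           ((c : KFrameMap.Fib updK (w , e , p)) → φ-after p c)
             ⇔ ((b : KFrameMap.Fib K w) → φ-after p (liftFib e p b))
  fibres p = ∀-updatedFibre⇔∀-lift K E RE Pre e p (φ-after p)
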